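{- (Provable in ${\sf RCA}_0$.) Let $T$ be a tree and $T^*=T^+\cup\{\sigma^\frown0\mid\sigma\in T^+\}$ where $T^+=\{\sigma+1\mid\sigma\in T\}$. Then: (1) $T$ is well-founded if and only if $T^*$ is well-founded; (2) $T$ has at most one infinite path if and only if $T^*$ has at most one infinite path; (3) $S$ is a perfect subtree of $T$ if and only if $S^+=\{\sigma+1\mid\sigma\in S\}$ is a perfect subtree of $T^*$; (4) $K$ is the perfect kernel of $T$ if and only if $K^+=\{\sigma+1\mid\sigma\in K\}$ is the perfect kernel of $T^*$.
   Context: A tree is a set of finite sequences of natural numbers closed under initial subsequences; it is well-founded if it has no infinite path. For a finite sequence $\sigma$, $\sigma+1$ is the sequence of the same length with $(\sigma+1)(n)=\sigma(n)+1$. A subtree $S$ of $T$ is perfect if every sequence in $S$ has two incompatible extensions in $S$. The perfect kernel of $T$ is the union of all perfect subtrees of $T$. -}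

module Defs where

open import Level using (0ℓ)
open import Data.Nat using (ℕ; suc)
open import Data.List using (List; []; _∷_; _++_; map; applyUpTo)
open import Data.Product using (Σ; _×_; _,_)
open import Data.Sum using (_⊎_)
open import Relation.Nullary using (¬_)
open import Relation.Unary using (Pred; _∈_; _⊆_)
open import Relation.Binary.PropositionalEquality using (_≡_)

Seq : Set
Seq = List ℕ

SeqSet : Set₁
SeqSet = Pred Seq 0ℓ

_⊑_ : Seq → Seq → Set
τ ⊑ σ = Σ Seq λ ρ → τ ++ ρ ≡ σ

Incompatible : Seq → Seq → Set
Incompatible τ ρ = ¬ (τ ⊑ ρ ⊎ ρ ⊑ τ)

IsTree : SeqSet → Set
IsTree T = ∀ {σ τ} → τ ⊑ σ → σ ∈ T → τ ∈ T

_↾_ : (ℕ → ℕ) → ℕ → Seq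
f ↾ n = applyUpTo f n

IsPath : (ℕ → ℕ) → SeqSet → Set
IsPath f T = ∀ n → (f ↾ n) ∈ T

WellFounded : SeqSet → Set
WellFounded T = ¬ (Σ (ℕ → ℕ) λ f → IsPath f T)

AtMostOnePath : SeqSet → Set
AtMostOnePath T = ∀ f g → IsPath f T → IsPath g T → ∀ n → f n ≡ g n

inc : Seq → Seq
inc σ = map suc σ

_⁺ : SeqSet → SeqSet
(S ⁺) τ = Σ Seq λ σ → σ ∈ S × τ ≡ inc σ

_* : SeqSet → SeqSet
(T *) τ = τ ∈ (T ⁺) ⊎ (Σ Seq λ σ → σ ∈ (T ⁺) × τ ≡ σ ++ (0 ∷ []))

IsPerfect : SeqSet → Set
IsPerfect S = ∀ σ → σ ∈ S →
  Σ Seq λ τ₁ → Σ Seq λ τ₂ →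
    σ ⊑ τ₁ × σ ⊑ τ₂ × τ₁ ∈ S × τ₂ ∈ S × Incompatible τ₁ τ₂

PerfectSubtree : SeqSet → SeqSet → Set
PerfectSubtree S T = IsTree S × S ⊆ T × IsPerfect S

IsPerfectKernel : SeqSet → SeqSet → Set₁
IsPerfectKernel K T =
  ∀ σ → (σ ∈ K → Σ SeqSet λ S → PerfectSubtree S T × σ ∈ S)
      × ((Σ SeqSet λ S → PerfectSubtree S T × σ ∈ S) → σ ∈ K)

module Submission where

-- The map σ ↦ σ+1 (inc) embeds sequences into sequences without
-- an entry 0; it is injective and both preserves and reflects the prefix
-- order.  T* consists of the image T⁺ together with the marker nodes α⌢0
-- (α ∈ T⁺), and every marker node is a leaf of T*.  Consequently:
--  * an infinite path of T* never meets a marker node, so the paths of T* are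
--    exactly the sequences suc ∘ f for paths f of T (inverse g ↦ pred ∘ g);
--    this gives parts (1) and (2);
--  * a perfect subtree of T* contains no leaf, hence lies inside T⁺, so the
--    push-forward S ↦ S⁺ and the pull-back S ↦ S⁻ along inc are mutually
--    inverse between perfect subtrees of T and of T*; this gives part (3);
--  * hence σ lies in a perfect subtree of T iff σ+1 lies in one of T*, and
--    every point of a perfect subtree of T* has the form σ+1; this gives (4).

open import Defs
open import Data.Product using (_×_)
open import Function.Bundles using (_⇔_)

open import Data.Nat using (zero; suc; pred)
open import Data.Nat.Properties using (suc-injective)
open import Data.List using (List; []; _∷_; _++_; map)
open import Data.List.Properties
  using (∷-injective; map-++; map-∘; map-id; map-injective; map-applyUpTo;
         ++-assoc; ++-identityʳ; applyUpTo-∷ʳ)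
open import Data.Product using (Σ; _,_; proj₁; proj₂)
open import Data.Sum using (inj₁; inj₂) renaming (map to ⊎-map)
open import Data.Empty using (⊥-elim)
open import Relation.Unary using (_∈_; _⊆_)
open import Relation.Binary.PropositionalEquality
  using (_≡_; _≢_; refl; sym; trans; cong; subst; module ≡-Reasoning)
open import Function using (_∘_)
open import Function.Bundles using (mk⇔; module Equivalence)

open ≡-Reasoning

map-++-inverse : ∀ {A B : Set} (f : A → B) τ ρ (σ : List A) → τ ++ ρ ≡ map f σ →
  Σ (List A) λ σ₁ → Σ (List A) λ σ₂ →
    σ₁ ++ σ₂ ≡ σ × τ ≡ map f σ₁ × ρ ≡ map f σ₂
map-++-inverse f []      ρ σ       e = [] , σ , refl , refl , e
map-++-inverse f (x ∷ τ) ρ []      ()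
map-++-inverse f (x ∷ τ) ρ (y ∷ σ) e with ∷-injective e
... | refl , e′ with map-++-inverse f τ ρ σ e′
...   | σ₁ , σ₂ , refl , refl , refl = y ∷ σ₁ , σ₂ , refl , refl , refl

inc-injective : ∀ {σ τ} → inc σ ≡ inc τ → σ ≡ τ
inc-injective = map-injective suc-injective

pred-inc : ∀ σ → map pred (inc σ) ≡ σ
pred-inc σ = trans (sym (map-∘ σ)) (map-id σ)

inc-⊑ : ∀ {τ σ} → τ ⊑ σ → inc τ ⊑ inc σ
inc-⊑ {τ} (ρ , refl) = inc ρ , sym (map-++ suc τ ρ)

inc-⊑⁻¹ : ∀ {τ σ} → inc τ ⊑ inc σ → τ ⊑ σ
inc-⊑⁻¹ {τ} {σ} (ρ , e) with map-++-inverse suc (inc τ) ρ σ e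
... | σ₁ , σ₂ , refl , τ≡σ₁ , _ = σ₂ , cong (_++ σ₂) (inc-injective τ≡σ₁)

⊑-inc : ∀ {τ σ} → τ ⊑ inc σ → Σ Seq λ ρ → ρ ⊑ σ × τ ≡ inc ρ
⊑-inc {τ} {σ} (ρ , e) with map-++-inverse suc τ ρ σ e
... | σ₁ , σ₂ , σ≡ , τ≡ , _ = σ₁ , (σ₂ , σ≡) , τ≡

inc-incompatible : ∀ {τ ρ} → Incompatible τ ρ → Incompatible (inc τ) (inc ρ)
inc-incompatible τ#ρ = τ#ρ ∘ ⊎-map inc-⊑⁻¹ inc-⊑⁻¹

inc-incompatible⁻¹ : ∀ {τ ρ} → Incompatible (inc τ) (inc ρ) → Incompatible τ ρ
inc-incompatible⁻¹ τ#ρ = τ#ρ ∘ ⊎-map inc-⊑ inc-⊑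

inc≢marked : ∀ σ α x → inc σ ≢ α ++ 0 ∷ x
inc≢marked σ α x e with map-++-inverse suc α (0 ∷ x) σ (sym e)
... | _ , []    , _ , _ , ()
... | _ , _ ∷ _ , _ , _ , ()

⁺-reflects : ∀ {S : SeqSet} {σ} → inc σ ∈ S ⁺ → σ ∈ S
⁺-reflects {S} (τ , s , e) = subst S (sym (inc-injective e)) s

*-reflects : ∀ {T : SeqSet} {σ} → inc σ ∈ T * → σ ∈ T
*-reflects         (inj₁ σ∈T⁺)        = ⁺-reflects σ∈T⁺
*-reflects {σ = σ} (inj₂ (α , _ , e)) = ⊥-elim (inc≢marked σ α [] e)

⁺-mono : ∀ {S T : SeqSet} → S ⊆ T → S ⁺ ⊆ T ⁺
⁺-mono S⊆T (σ , s , e) = σ , S⊆T s , e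

-- the only entry 0 of a marker β+1⌢0 is its last one
marker-last : ∀ α x β → α ++ 0 ∷ x ≡ inc β ++ 0 ∷ [] → x ≡ []
marker-last []      x []      e = proj₂ (∷-injective e)
marker-last []      x (_ ∷ _) ()
marker-last (_ ∷ []) x []     ()
marker-last (_ ∷ _ ∷ _) x []  ()
marker-last (_ ∷ α) x (_ ∷ β) e = marker-last α x β (proj₂ (∷-injective e))

marker-leaf : ∀ (T : SeqSet) α x → (α ++ 0 ∷ []) ++ x ∈ T * → x ≡ []
marker-leaf T α x (inj₁ (β , _ , e)) =
  ⊥-elim (inc≢marked β α x (trans (sym e) (++-assoc α (0 ∷ []) x)))
marker-leaf T α x (inj₂ (_ , (β , _ , refl) , e)) =
  marker-last α x β (trans (sym (++-assoc α (0 ∷ []) x)) e)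

↾-suc : ∀ f n → f ↾ suc n ≡ f ↾ n ++ f n ∷ []
↾-suc f n = sym (applyUpTo-∷ʳ f n)

inc-path : ∀ {T f} → IsPath f T → IsPath (suc ∘ f) (T *)
inc-path {f = f} p n = inj₁ (f ↾ n , p n , sym (map-applyUpTo f suc n))

-- a path of T* runs inside T⁺, since the marker nodes are leaves
path-in-⁺ : ∀ {T g} → IsPath g (T *) → ∀ n → g ↾ n ∈ T ⁺
path-in-⁺ {T} {g} p n with p n
... | inj₁ gn∈T⁺ = gn∈T⁺
... | inj₂ (α , _ , e) with marker-leaf T α (g n ∷ []) extension
  where
  extension : (α ++ 0 ∷ []) ++ g n ∷ [] ∈ T *
  extension = subst (_∈ T *) (trans (↾-suc g n) (cong (_++ g n ∷ []) e)) (p (suc n))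
... | ()

path-positive : ∀ {T g} → IsPath g (T *) → ∀ n → g n ≡ suc (pred (g n))
path-positive {T} {g} p n with path-in-⁺ p (suc n) | g n in gn≡
... | _ , _ , _ | suc _ = refl
... | β , _ , e | zero  = ⊥-elim (inc≢marked β (g ↾ n) [] (begin
  inc β                  ≡⟨ sym e ⟩
  g ↾ suc n              ≡⟨ ↾-suc g n ⟩
  g ↾ n ++ g n ∷ []      ≡⟨ cong (λ m → g ↾ n ++ m ∷ []) gn≡ ⟩
  g ↾ n ++ 0 ∷ []        ∎))

pred-path : ∀ {T g} → IsPath g (T *) → IsPath (pred ∘ g) T
pred-path {T} {g} p n with path-in-⁺ p n
... | β , β∈T , e = subst T (sym pred-g≡β) β∈T
  where
  pred-g≡β : (pred ∘ g) ↾ n ≡ β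
  pred-g≡β = begin
    (pred ∘ g) ↾ n      ≡⟨ sym (map-applyUpTo g pred n) ⟩
    map pred (g ↾ n)    ≡⟨ cong (map pred) e ⟩
    map pred (inc β)    ≡⟨ pred-inc β ⟩
    β                   ∎

wellFounded⇔ : ∀ T → WellFounded T ⇔ WellFounded (T *)
wellFounded⇔ T = mk⇔ (λ wf (g , p) → wf (pred ∘ g , pred-path p))
                     (λ wf (f , p) → wf (suc ∘ f , inc-path p))

atMostOnePath⇔ : ∀ T → AtMostOnePath T ⇔ AtMostOnePath (T *)
atMostOnePath⇔ T = mk⇔ to from
  where
  to : AtMostOnePath T → AtMostOnePath (T *)
  to unique f g pf pg n = begin
    f n                 ≡⟨ path-positive pf n ⟩
    suc (pred (f n))    ≡⟨ cong suc (unique _ _ (pred-path pf) (pred-path pg) n) ⟩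
    suc (pred (g n))    ≡⟨ sym (path-positive pg n) ⟩
    g n                 ∎
  from : AtMostOnePath (T *) → AtMostOnePath T
  from unique f g pf pg n = suc-injective (unique _ _ (inc-path pf) (inc-path pg) n)

_⁻ : SeqSet → SeqSet
(S ⁻) σ = inc σ ∈ S

⁺-tree : ∀ {S} → IsTree S → IsTree (S ⁺)
⁺-tree tree τ⊑ (σ , s , refl) with ⊑-inc τ⊑
... | ρ , ρ⊑σ , refl = ρ , tree ρ⊑σ s , refl

⁻-tree : ∀ {S} → IsTree S → IsTree (S ⁻)
⁻-tree tree τ⊑σ s = tree (inc-⊑ τ⊑σ) s

⁺-perfect : ∀ {S} → IsPerfect S → IsPerfect (S ⁺)
⁺-perfect perfect .(inc σ) (σ , s , refl) with perfect σ s
... | τ₁ , τ₂ , σ⊑τ₁ , σ⊑τ₂ , s₁ , s₂ , τ₁#τ₂ =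
  inc τ₁ , inc τ₂ , inc-⊑ σ⊑τ₁ , inc-⊑ σ⊑τ₂ ,
  (τ₁ , s₁ , refl) , (τ₂ , s₂ , refl) , inc-incompatible τ₁#τ₂

⁻-perfect : ∀ {S T} → S ⊆ T ⁺ → IsPerfect S → IsPerfect (S ⁻)
⁻-perfect S⊆T⁺ perfect σ s with perfect (inc σ) s
... | τ₁ , τ₂ , l₁ , l₂ , s₁ , s₂ , τ₁#τ₂ with S⊆T⁺ s₁ | S⊆T⁺ s₂
...   | β₁ , _ , refl | β₂ , _ , refl =
  β₁ , β₂ , inc-⊑⁻¹ l₁ , inc-⊑⁻¹ l₂ , s₁ , s₂ , inc-incompatible⁻¹ τ₁#τ₂

-- a perfect subset of T* contains no marker node, these being leaves
perfect-in-⁺ : ∀ {S T} → S ⊆ T * → IsPerfect S → S ⊆ T ⁺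
perfect-in-⁺ {T = T} S⊆T* perfect s with S⊆T* s
... | inj₁ ρ∈T⁺ = ρ∈T⁺
... | inj₂ (α , _ , refl) with perfect _ s
...   | _ , _ , (x₁ , refl) , (x₂ , refl) , s₁ , s₂ , τ₁#τ₂
      with marker-leaf T α x₁ (S⊆T* s₁) | marker-leaf T α x₂ (S⊆T* s₂)
...     | refl | refl = ⊥-elim (τ₁#τ₂ (inj₁ ([] , ++-identityʳ _)))

⁺-perfectSubtree : ∀ {S T} → PerfectSubtree S T → PerfectSubtree (S ⁺) (T *)
⁺-perfectSubtree (tree , S⊆T , perfect) =
  ⁺-tree tree , inj₁ ∘ ⁺-mono S⊆T , ⁺-perfect perfect

⁻-perfectSubtree : ∀ {S T} → PerfectSubtree S (T *) → PerfectSubtree (S ⁻) T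
⁻-perfectSubtree (tree , S⊆T* , perfect) =
  ⁻-tree tree , *-reflects ∘ S⊆T* , ⁻-perfect (perfect-in-⁺ S⊆T* perfect) perfect

perfectSubtree-resp : ∀ {A B T} → A ⊆ B → B ⊆ A →
  PerfectSubtree A T → PerfectSubtree B T
perfectSubtree-resp A⊆B B⊆A (tree , A⊆T , perfect) =
  (λ τ⊑σ b → A⊆B (tree τ⊑σ (B⊆A b))) , A⊆T ∘ B⊆A ,
  λ σ b → let τ₁ , τ₂ , l₁ , l₂ , a₁ , a₂ , τ₁#τ₂ = perfect σ (B⊆A b)
          in  τ₁ , τ₂ , l₁ , l₂ , A⊆B a₁ , A⊆B a₂ , τ₁#τ₂

perfectSubtree⇔ : ∀ T S → PerfectSubtree S T ⇔ PerfectSubtree (S ⁺) (T *)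
perfectSubtree⇔ T S = mk⇔ ⁺-perfectSubtree
  (perfectSubtree-resp ⁺-reflects (λ s → _ , s , refl) ∘ ⁻-perfectSubtree)

InPerfectSubtree : SeqSet → Seq → Set₁
InPerfectSubtree T σ = Σ SeqSet λ S → PerfectSubtree S T × σ ∈ S

inPerfectSubtree-inc : ∀ T σ →
  InPerfectSubtree T σ ⇔ InPerfectSubtree (T *) (inc σ)
inPerfectSubtree-inc T σ = mk⇔
  (λ (S , ps , s) → S ⁺ , ⁺-perfectSubtree ps , (σ , s , refl))
  (λ (S , ps , s) → S ⁻ , ⁻-perfectSubtree ps , s)

inPerfectSubtree-⁺ : ∀ T τ → InPerfectSubtree (T *) τ → τ ∈ T ⁺
inPerfectSubtree-⁺ T τ (S , (_ , S⊆T* , perfect) , s) = perfect-in-⁺ S⊆T* perfect s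

perfectKernel⇔ : ∀ T K → IsPerfectKernel K T ⇔ IsPerfectKernel (K ⁺) (T *)
perfectKernel⇔ T K = mk⇔ to from
  where
  open Equivalence using () renaming (to to ⇒; from to ⇐)
  to : IsPerfectKernel K T → IsPerfectKernel (K ⁺) (T *)
  to kernel τ = inside , covers
    where
    inside : τ ∈ K ⁺ → InPerfectSubtree (T *) τ
    inside (σ , σ∈K , refl) = ⇒ (inPerfectSubtree-inc T σ) (proj₁ (kernel σ) σ∈K)
    covers : InPerfectSubtree (T *) τ → τ ∈ K ⁺
    covers p with inPerfectSubtree-⁺ T τ p
    ... | σ , _ , refl = σ , proj₂ (kernel σ) (⇐ (inPerfectSubtree-inc T σ) p) , refl
  from : IsPerfectKernel (K ⁺) (T *) → IsPerfectKernel K T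
  from kernel σ =
    (λ σ∈K → ⇐ (inPerfectSubtree-inc T σ) (proj₁ (kernel (inc σ)) (σ , σ∈K , refl))) ,
    (λ p → ⁺-reflects (proj₂ (kernel (inc σ)) (⇒ (inPerfectSubtree-inc T σ) p)))

theorem6 : (T : SeqSet) → IsTree T →
    (WellFounded T ⇔ WellFounded (T *))
    × (AtMostOnePath T ⇔ AtMostOnePath (T *))
    × (∀ (S : SeqSet) → PerfectSubtree S T ⇔ PerfectSubtree (S ⁺) (T *))
    × (∀ (K : SeqSet) → IsPerfectKernel K T ⇔ IsPerfectKernel (K ⁺) (T *))
theorem6 T _ =
  wellFounded⇔ T , atMostOnePath⇔ T , perfectSubtree⇔ T , perfectKernel⇔ T
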